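{- Let $Q$ be a stably supported quantale. There is a bijective correspondence between the pairs $(\alpha,v)$ such that $(Q,\alpha,v)$ is a generalized Kripke model and the homomorphisms of unital involutive quantales $h:\mathrm{Lind}_K\to Q$, given by $\alpha=h(\boldsymbol{\alpha})$ and $v(\varphi)=h([\varphi])$ (where $[\varphi]$ is the image of the class of $\varphi$ in $B_K$). In particular, for a set $W$, a homomorphism $\rho:\mathrm{Lind}_K\to\mathcal{P}(W\times W)$ is the same as a model of system K with set of possible worlds $W$ and accessibility relation $\rho(\boldsymbol{\alpha})$.
   Context: Quantale: complete lattice with associative multiplication distributing over arbitrary joins; unital (unit $e$); involutive (join-preserving $a\mapsto a^*$, $(ab)^*=b^*a^*$, $a^{**}=a$); homomorphisms preserve joins, product, unit, involution. A support on a unital involutive quantale is a join-preserving $\varsigma$ with $\varsigma a\le e$, $\varsigma a\le aa^*$, $a\le(\varsigma a)a$; stable if $\varsigma(ab)=\varsigma(a\varsigma b)$; a stably supported quantale (ssq) has a stable support (unique when it exists, and preserved by all unital involutive quantale homomorphisms between ssqs); $\varsigma Q=\{a\mid a\le e\}$. $\mathcal{P}(W\times W)$ (binary relations, union, composition, converse, unit the diagonal, $\varsigma R=\{(x,x)\mid\exists y\,(x,y)\in R\}$) is an ssq. Formulas $\Phi$: built from propositional symbols with $\neg,\vee,\lozenge$. A generalized Kripke model is $(Q,\alpha,v)$ with $Q$ an ssq, $\alpha\in Q$, $v:\Phi\to\varsigma Q$ with $v(\varphi\vee\psi)=v(\varphi)\vee v(\psi)$, $v(\varphi)v(\neg\varphi)=0$,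 $v(\varphi)\vee v(\neg\varphi)=e$, $v(\lozenge\varphi)=\varsigma(\alpha v(\varphi))$. $B_K$ is the Lindenbaum algebra of modal system K. $\mathrm{Lind}_K$ is the pointed ssq $(\mathrm{Lind}_K,\boldsymbol{\alpha})$ presented by generators $B_K$ and relations $[x\vee y]=[x]\vee[y]$, $[\neg x][x]=0$, $[\neg x]\vee[x]=e$, $[\lozenge x]=\varsigma(\boldsymbol{\alpha}[x])$: for every ssq $Q$, $a\in Q$ and map $f:B_K\to Q$ satisfying these relations with $a$ for $\boldsymbol{\alpha}$, there is a unique homomorphism $h:\mathrm{Lind}_K\to Q$ with $h(\boldsymbol{\alpha})=a$ and $h([x])=f(x)$. -}

module Defs where

open import Level using (Level; _⊔_; suc; 0ℓ)
open import Data.Bool using (Bool; true; false)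
open import Data.Empty using (⊥)
open import Data.Product using (Σ; Σ-syntax; _×_; _,_)
open import Relation.Binary.Core using (Rel)
open import Relation.Binary.Structures using (IsPartialOrder)

record Quantale (c ℓ ι : Level) : Set (suc (c ⊔ ℓ ⊔ ι)) where
  infix  4 _≈_ _≤_
  infixl 7 _·_
  field
    Carrier : Set c
    _≈_     : Rel Carrier ℓ
    _≤_     : Rel Carrier ℓ
    isPartialOrder : IsPartialOrder _≈_ _≤_
    ⋁       : {I : Set ι} → (I → Carrier) → Carrier
    ⋁-upper : {I : Set ι} (f : I → Carrier) (i : I) → f i ≤ ⋁ f
    ⋁-least : {I : Set ι} (f : I → Carrier) (b : Carrier) →
              ((i : I) → f i ≤ b) → ⋁ f ≤ b
    _·_     : Carrier → Carrier → Carrier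
    ·-cong  : ∀ {a a′ b b′} → a ≈ a′ → b ≈ b′ → a · b ≈ a′ · b′
    ·-assoc : ∀ a b c → (a · b) · c ≈ a · (b · c)
    ·-distribˡ-⋁ : ∀ a {I : Set ι} (f : I → Carrier) → a · ⋁ f ≈ ⋁ (λ i → a · f i)
    ·-distribʳ-⋁ : ∀ a {I : Set ι} (f : I → Carrier) → ⋁ f · a ≈ ⋁ (λ i → f i · a)
    e       : Carrier
    e-identityˡ : ∀ a → e · a ≈ a
    e-identityʳ : ∀ a → a · e ≈ a
    _*      : Carrier → Carrier
    *-cong  : ∀ {a b} → a ≈ b → a * ≈ b *
    *-⋁     : {I : Set ι} (f : I → Carrier) → (⋁ f) * ≈ ⋁ (λ i → f i *)
    *-·     : ∀ a b → (a · b) * ≈ (b *) · (a *)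
    *-invol : ∀ a → (a *) * ≈ a

  _∨_ : Carrier → Carrier → Carrier
  a ∨ b = ⋁ {I = Level.Lift ι Bool} (λ { (Level.lift true) → a ; (Level.lift false) → b })

  𝟘 : Carrier
  𝟘 = ⋁ {I = Level.Lift ι ⊥} (λ ())

  infixr 6 _∨_

record IsSupport {c ℓ ι} (Q : Quantale c ℓ ι) (ς : Quantale.Carrier Q → Quantale.Carrier Q)
       : Set (c ⊔ ℓ ⊔ suc ι) where
  open Quantale Q
  field
    ς-cong : ∀ {a b} → a ≈ b → ς a ≈ ς b
    ς-⋁    : {I : Set ι} (f : I → Carrier) → ς (⋁ f) ≈ ⋁ (λ i → ς (f i))
    ς-≤e   : ∀ a → ς a ≤ e
    ς-≤aa* : ∀ a → ς a ≤ a · (a *)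
    ≤ςa·a  : ∀ a → a ≤ ς a · a

record IsStableSupport {c ℓ ι} (Q : Quantale c ℓ ι) (ς : Quantale.Carrier Q → Quantale.Carrier Q)
       : Set (c ⊔ ℓ ⊔ suc ι) where
  open Quantale Q
  field
    isSupport : IsSupport Q ς
    stable    : ∀ a b → ς (a · b) ≈ ς (a · ς b)
  open IsSupport isSupport public

record SSQ (c ℓ ι : Level) : Set (suc (c ⊔ ℓ ⊔ ι)) where
  field
    quantale : Quantale c ℓ ι
  open Quantale quantale public
  field
    ς : Carrier → Carrier
    isStableSupport : IsStableSupport quantale ς

record Hom {c₁ ℓ₁ c₂ ℓ₂ ι} (A : SSQ c₁ ℓ₁ ι) (B : SSQ c₂ ℓ₂ ι)
       : Set (c₁ ⊔ ℓ₁ ⊔ c₂ ⊔ ℓ₂ ⊔ suc ι) where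
  private
    module A = SSQ A
    module B = SSQ B
  field
    ⟦_⟧    : A.Carrier → B.Carrier
    cong   : ∀ {a b} → a A.≈ b → ⟦ a ⟧ B.≈ ⟦ b ⟧
    pres-⋁ : {I : Set ι} (f : I → A.Carrier) → ⟦ A.⋁ f ⟧ B.≈ B.⋁ (λ i → ⟦ f i ⟧)
    pres-· : ∀ a b → ⟦ a A.· b ⟧ B.≈ ⟦ a ⟧ B.· ⟦ b ⟧
    pres-e : ⟦ A.e ⟧ B.≈ B.e
    pres-* : ∀ a → ⟦ a A.* ⟧ B.≈ ⟦ a ⟧ B.*

open Hom public using (⟦_⟧)

data Fm (P : Set) : Set where
  var  : P → Fm P
  ¬_   : Fm P → Fm P
  _∨ᶠ_ : Fm P → Fm P → Fm P
  ◇_   : Fm P → Fm P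

infix  9 ¬_ ◇_
infixr 6 _∨ᶠ_

module _ {P : Set} where
  infixr 5 _⇒_
  _⇒_ : Fm P → Fm P → Fm P
  φ ⇒ ψ = (¬ φ) ∨ᶠ ψ

  □_ : Fm P → Fm P
  □ φ = ¬ (◇ (¬ φ))

  -- Theorems of the minimal normal modal logic K:
  -- classical propositional logic in ¬,∨ (Principia / Hilbert–Ackermann axioms),
  -- modus ponens, the K axiom, the duality axiom ◇φ ↔ ¬□¬φ, necessitation.
  data ⊢K_ : Fm P → Set where
    taut  : ∀ φ → ⊢K ((φ ∨ᶠ φ) ⇒ φ)
    add   : ∀ φ ψ → ⊢K (ψ ⇒ (φ ∨ᶠ ψ))
    perm  : ∀ φ ψ → ⊢K ((φ ∨ᶠ ψ) ⇒ (ψ ∨ᶠ φ))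
    assoc : ∀ φ ψ χ → ⊢K ((φ ∨ᶠ (ψ ∨ᶠ χ)) ⇒ (ψ ∨ᶠ (φ ∨ᶠ χ)))
    sum   : ∀ φ ψ χ → ⊢K ((ψ ⇒ χ) ⇒ ((φ ∨ᶠ ψ) ⇒ (φ ∨ᶠ χ)))
    axK   : ∀ φ ψ → ⊢K (□ (φ ⇒ ψ) ⇒ (□ φ ⇒ □ ψ))
    dual₁ : ∀ φ → ⊢K (◇ φ ⇒ ¬ (□ (¬ φ)))
    dual₂ : ∀ φ → ⊢K (¬ (□ (¬ φ)) ⇒ ◇ φ)
    mp    : ∀ {φ ψ} → ⊢K φ → ⊢K (φ ⇒ ψ) → ⊢K ψ
    nec   : ∀ {φ} → ⊢K φ → ⊢K (□ φ)

  -- The Lindenbaum algebra B_K is Fm P modulo K-provable equivalence;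
  -- we work with it as a setoid: a map out of B_K is a map out of Fm P
  -- that respects _∼K_.
  _∼K_ : Fm P → Fm P → Set
  φ ∼K ψ = (⊢K (φ ⇒ ψ)) × (⊢K (ψ ⇒ φ))

record IsKripkeModel {c ℓ ι} {P : Set} (Q : SSQ c ℓ ι)
       (α : SSQ.Carrier Q) (v : Fm P → SSQ.Carrier Q) : Set (ℓ ⊔ c) where
  open SSQ Q
  field
    v-ςQ : ∀ φ → v φ ≤ e                        -- v : Φ → ςQ
    v-∨  : ∀ φ ψ → v (φ ∨ᶠ ψ) ≈ (v φ ∨ v ψ)
    v-¬· : ∀ φ → v φ · v (¬ φ) ≈ 𝟘
    v-¬∨ : ∀ φ → (v φ ∨ v (¬ φ)) ≈ e
    v-◇  : ∀ φ → v (◇ φ) ≈ ς (α · v φ)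

-- The relations of the presentation of Lind_K, for a map f : B_K → Q
-- (i.e. f : Fm P → Q respecting ∼K) and an element a in place of 𝛂.

record SatisfiesLindRelations {c ℓ ι} {P : Set} (Q : SSQ c ℓ ι)
       (a : SSQ.Carrier Q) (f : Fm P → SSQ.Carrier Q) : Set (ℓ ⊔ c) where
  open SSQ Q
  field
    f-resp : ∀ {φ ψ} → φ ∼K ψ → f φ ≈ f ψ
    r-∨    : ∀ φ ψ → f (φ ∨ᶠ ψ) ≈ (f φ ∨ f ψ)
    r-¬·   : ∀ φ → f (¬ φ) · f φ ≈ 𝟘
    r-¬∨   : ∀ φ → (f (¬ φ) ∨ f φ) ≈ e
    r-◇    : ∀ φ → f (◇ φ) ≈ ς (a · f φ)

-- (L, 𝛂, gen) is the pointed ssq presented by generators B_K and the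
-- relations above (universal property w.r.t. ssqs at levels c ℓ ι).
record IsLindK (c ℓ ι : Level) {c₁ ℓ₁} {P : Set} (L : SSQ c₁ ℓ₁ ι)
       (𝛂 : SSQ.Carrier L) (gen : Fm P → SSQ.Carrier L)
       : Set (c₁ ⊔ ℓ₁ ⊔ suc (c ⊔ ℓ ⊔ ι)) where
  field
    gen-rel   : SatisfiesLindRelations L 𝛂 gen
    universal : (Q : SSQ c ℓ ι) (a : SSQ.Carrier Q) (f : Fm P → SSQ.Carrier Q) →
                SatisfiesLindRelations Q a f →
                Σ[ h ∈ Hom L Q ] ((SSQ._≈_ Q (⟦ h ⟧ 𝛂) a) ×
                                  (∀ φ → SSQ._≈_ Q (⟦ h ⟧ (gen φ)) (f φ)))
    unique    : (Q : SSQ c ℓ ι) (h h′ : Hom L Q) →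
                SSQ._≈_ Q (⟦ h ⟧ 𝛂) (⟦ h′ ⟧ 𝛂) →
                (∀ φ → SSQ._≈_ Q (⟦ h ⟧ (gen φ)) (⟦ h′ ⟧ (gen φ))) →
                ∀ x → SSQ._≈_ Q (⟦ h ⟧ x) (⟦ h′ ⟧ x)

module Submission where

-- In a stably supported quantale the elements below e are self-adjoint and hence commute,
-- so the values of a generalized Kripke model form a Boolean algebra with v(¬φ) the
-- complement of v(φ), on which ◇ acts through the join-preserving map x ↦ ς(αx). This makes
-- the semantics sound for K, so v respects provable equivalence and (α, v) satisfies the
-- defining relations of Lind_K; the universal property then yields h. Conversely, a
-- homomorphism preserves the stable support, so it carries the relations holding in Lind_K
-- to a model, and injectivity is the uniqueness clause of the presentation.

open import Defs
open import Level using (Level; lift)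
open import Data.Bool using (true; false)
open import Data.Product using (Σ-syntax; _×_; _,_)
open import Relation.Binary.Bundles using (Poset)
open import Relation.Binary.Structures using (IsEquivalence)
import Relation.Binary.Reasoning.PartialOrder as PartialOrderReasoning

module JoinLattice {c ℓ ι} (Q : Quantale c ℓ ι) where
  open Quantale Q

  poset : Poset c ℓ ℓ
  poset = record { isPartialOrder = isPartialOrder }

  open Poset poset public using ()
    renaming (refl to ≤-refl; trans to ≤-trans; antisym to ≤-antisym; reflexive to ≤-reflexive)
  open IsEquivalence (Poset.isEquivalence poset) public using ()
    renaming (refl to ≈-refl; sym to ≈-sym; trans to ≈-trans)
  module ≤-Reasoning = PartialOrderReasoning poset

  ∨-upperˡ : ∀ a b → a ≤ a ∨ b
  ∨-upperˡ a b = ⋁-upper _ (lift true)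

  ∨-upperʳ : ∀ a b → b ≤ a ∨ b
  ∨-upperʳ a b = ⋁-upper _ (lift false)

  ∨-least : ∀ {a b x} → a ≤ x → b ≤ x → a ∨ b ≤ x
  ∨-least {x = x} a≤x b≤x = ⋁-least _ x λ { (lift true) → a≤x ; (lift false) → b≤x }

  ∨-mono : ∀ {a a′ b b′} → a ≤ a′ → b ≤ b′ → a ∨ b ≤ a′ ∨ b′
  ∨-mono a≤a′ b≤b′ = ∨-least (≤-trans a≤a′ (∨-upperˡ _ _)) (≤-trans b≤b′ (∨-upperʳ _ _))

  ∨-comm : ∀ a b → a ∨ b ≈ b ∨ a
  ∨-comm a b = ≤-antisym (∨-least (∨-upperʳ b a) (∨-upperˡ b a))
                         (∨-least (∨-upperʳ a b) (∨-upperˡ a b))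

  x≤y⇒x∨y≈y : ∀ {x y} → x ≤ y → x ∨ y ≈ y
  x≤y⇒x∨y≈y x≤y = ≤-antisym (∨-least x≤y ≤-refl) (∨-upperʳ _ _)

  𝟘-least : ∀ a → 𝟘 ≤ a
  𝟘-least a = ⋁-least _ a λ { (lift ()) }

  ⋁-cong : ∀ {I : Set ι} {f g : I → Carrier} → (∀ i → f i ≈ g i) → ⋁ f ≈ ⋁ g
  ⋁-cong {f = f} {g} f≈g = ≤-antisym
    (⋁-least f (⋁ g) λ i → ≤-trans (≤-reflexive (f≈g i)) (⋁-upper g i))
    (⋁-least g (⋁ f) λ i → ≤-trans (≤-reflexive (≈-sym (f≈g i))) (⋁-upper f i))

module JoinPreserving {c₁ ℓ₁ c₂ ℓ₂ ι} (A : Quantale c₁ ℓ₁ ι) (B : Quantale c₂ ℓ₂ ι)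
  (g : Quantale.Carrier A → Quantale.Carrier B)
  (g-cong : ∀ {a b} → Quantale._≈_ A a b → Quantale._≈_ B (g a) (g b))
  (g-⋁ : ∀ {I : Set ι} (f : I → Quantale.Carrier A) →
         Quantale._≈_ B (g (Quantale.⋁ A f)) (Quantale.⋁ B (λ i → g (f i)))) where
  private
    module A = Quantale A
    module B = Quantale B
    module LA = JoinLattice A
  open JoinLattice B

  pres-∨ : ∀ a b → g (a A.∨ b) B.≈ g a B.∨ g b
  pres-∨ a b = ≈-trans (g-⋁ _) (⋁-cong λ { (lift true) → ≈-refl ; (lift false) → ≈-refl })

  pres-𝟘 : g A.𝟘 B.≈ B.𝟘
  pres-𝟘 = ≈-trans (g-⋁ _) (⋁-cong λ { (lift ()) })

  mono : ∀ {a b} → a A.≤ b → g a B.≤ g b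
  mono {a} {b} a≤b = begin
    g a           ≤⟨ ∨-upperˡ (g a) (g b) ⟩
    g a B.∨ g b   ≈⟨ pres-∨ a b ⟨
    g (a A.∨ b)   ≈⟨ g-cong (LA.x≤y⇒x∨y≈y a≤b) ⟩
    g b           ∎
    where open ≤-Reasoning

module QuantaleProperties {c ℓ ι} (Q : Quantale c ℓ ι) where
  open Quantale Q
  open JoinLattice Q
  private
    module Left  (a : Carrier) = JoinPreserving Q Q (a ·_) (·-cong ≈-refl) (·-distribˡ-⋁ a)
    module Right (a : Carrier) = JoinPreserving Q Q (_· a) (λ p → ·-cong p ≈-refl) (·-distribʳ-⋁ a)
    module Star = JoinPreserving Q Q _* *-cong *-⋁

  ·-monoʳ : ∀ a {b b′} → b ≤ b′ → a · b ≤ a · b′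
  ·-monoʳ a = Left.mono a

  ·-monoˡ : ∀ a {b b′} → b ≤ b′ → b · a ≤ b′ · a
  ·-monoˡ a = Right.mono a

  ·-distribˡ-∨ : ∀ a b d → a · (b ∨ d) ≈ a · b ∨ a · d
  ·-distribˡ-∨ a = Left.pres-∨ a

  ·-distribʳ-∨ : ∀ a b d → (b ∨ d) · a ≈ b · a ∨ d · a
  ·-distribʳ-∨ a = Right.pres-∨ a

  *-mono : ∀ {a b} → a ≤ b → a * ≤ b *
  *-mono = Star.mono

  e*≈e : e * ≈ e
  e*≈e = begin-equality
    e *             ≈⟨ e-identityʳ (e *) ⟨
    e * · e         ≈⟨ ·-cong ≈-refl (*-invol e) ⟨
    e * · (e *) *   ≈⟨ *-· (e *) e ⟨
    (e * · e) *     ≈⟨ *-cong (e-identityʳ (e *)) ⟩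
    (e *) *         ≈⟨ *-invol e ⟩
    e               ∎
    where open ≤-Reasoning

module SupportProperties {c ℓ ι} (Q : SSQ c ℓ ι) where
  open SSQ Q
  open JoinLattice quantale
  open QuantaleProperties quantale
  open IsStableSupport isStableSupport
  open ≤-Reasoning

  ς-mono : ∀ {a b} → a ≤ b → ς a ≤ ς b
  ς-mono = JoinPreserving.mono quantale quantale ς ς-cong ς-⋁

  x≤e⇒x*≤e : ∀ {x} → x ≤ e → x * ≤ e
  x≤e⇒x*≤e x≤e = ≤-trans (*-mono x≤e) (≤-reflexive e*≈e)

  y≤e⇒x·y≤x : ∀ {x y} → y ≤ e → x · y ≤ x
  y≤e⇒x·y≤x {x} y≤e = ≤-trans (·-monoʳ x y≤e) (≤-reflexive (e-identityʳ x))

  x≤e⇒x·y≤y : ∀ {x y} → x ≤ e → x · y ≤ y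
  x≤e⇒x·y≤y {y = y} x≤e = ≤-trans (·-monoˡ y x≤e) (≤-reflexive (e-identityˡ y))

  x,y≤e⇒x·y≤e : ∀ {x y} → x ≤ e → y ≤ e → x · y ≤ e
  x,y≤e⇒x·y≤e x≤e y≤e = ≤-trans (y≤e⇒x·y≤x y≤e) x≤e

  x≤e⇒ςx≈x : ∀ {x} → x ≤ e → ς x ≈ x
  x≤e⇒ςx≈x {x} x≤e = ≤-antisym
    (≤-trans (ς-≤aa* x) (y≤e⇒x·y≤x (x≤e⇒x*≤e x≤e)))
    (≤-trans (≤ςa·a x) (y≤e⇒x·y≤x x≤e))

  x≤e⇒x·x*≈x : ∀ {x} → x ≤ e → x · x * ≈ x
  x≤e⇒x·x*≈x {x} x≤e = ≤-antisym (y≤e⇒x·y≤x (x≤e⇒x*≤e x≤e)) (begin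
    x         ≈⟨ x≤e⇒ςx≈x x≤e ⟨
    ς x       ≤⟨ ς-≤aa* x ⟩
    x · x *   ∎)

  x≤e⇒x*≈x : ∀ {x} → x ≤ e → x * ≈ x
  x≤e⇒x*≈x {x} x≤e = begin-equality
    x *              ≈⟨ *-cong (x≤e⇒x·x*≈x x≤e) ⟨
    (x · x *) *      ≈⟨ *-· x (x *) ⟩
    (x *) * · x *    ≈⟨ ·-cong (*-invol x) ≈-refl ⟩
    x · x *          ≈⟨ x≤e⇒x·x*≈x x≤e ⟩
    x                ∎

  x,y≤e⇒x·y≈y·x : ∀ {x y} → x ≤ e → y ≤ e → x · y ≈ y · x
  x,y≤e⇒x·y≈y·x {x} {y} x≤e y≤e = begin-equality
    x · y         ≈⟨ x≤e⇒x*≈x (x,y≤e⇒x·y≤e x≤e y≤e) ⟨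
    (x · y) *     ≈⟨ *-· x y ⟩
    y * · x *     ≈⟨ ·-cong (x≤e⇒x*≈x y≤e) (x≤e⇒x*≈x x≤e) ⟩
    y · x         ∎

  b≤e⇒ς[b·a]≤b : ∀ {a b} → b ≤ e → ς (b · a) ≤ b
  b≤e⇒ς[b·a]≤b {a} {b} b≤e = begin
    ς (b · a)     ≈⟨ stable b a ⟩
    ς (b · ς a)   ≈⟨ x≤e⇒ςx≈x (x,y≤e⇒x·y≤e b≤e (ς-≤e a)) ⟩
    b · ς a       ≤⟨ y≤e⇒x·y≤x (ς-≤e a) ⟩
    b             ∎

  ς-least : ∀ {a b} → b ≤ e → a ≤ b · a → ς a ≤ b
  ς-least b≤e a≤ba = ≤-trans (ς-mono a≤ba) (b≤e⇒ς[b·a]≤b b≤e)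

  ς[a·a*]≤ςa : ∀ a → ς (a · a *) ≤ ς a
  ς[a·a*]≤ςa a = ς-least (ς-≤e a) (begin
    a · a *           ≤⟨ ·-monoˡ (a *) (≤ςa·a a) ⟩
    (ς a · a) · a *   ≈⟨ ·-assoc (ς a) a (a *) ⟩
    ς a · (a · a *)   ∎)

module HomProperties {c₁ ℓ₁ c₂ ℓ₂ ι} {A : SSQ c₁ ℓ₁ ι} {B : SSQ c₂ ℓ₂ ι} (h : Hom A B) where
  private
    module A = SSQ A
    module SA = IsStableSupport A.isStableSupport
  open SSQ B
  open IsStableSupport isStableSupport using (ς-cong)
  open JoinLattice quantale
  open SupportProperties B
  open Hom h using (cong; pres-⋁; pres-·; pres-e; pres-*)
  open JoinPreserving A.quantale quantale ⟦ h ⟧ cong pres-⋁ public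
  open ≤-Reasoning

  pres-≤e : ∀ {a} → a A.≤ A.e → ⟦ h ⟧ a ≤ e
  pres-≤e a≤e = ≤-trans (mono a≤e) (≤-reflexive pres-e)

  pres-ς : ∀ a → ⟦ h ⟧ (A.ς a) ≈ ς (⟦ h ⟧ a)
  pres-ς a = ≤-antisym ⟦ςa⟧≤ς⟦a⟧ (ς-least ⟦ςa⟧≤e ⟦a⟧≤⟦ςa⟧·⟦a⟧)
    where
    ⟦ςa⟧≤e : ⟦ h ⟧ (A.ς a) ≤ e
    ⟦ςa⟧≤e = pres-≤e (SA.ς-≤e a)

    ⟦a⟧≤⟦ςa⟧·⟦a⟧ : ⟦ h ⟧ a ≤ ⟦ h ⟧ (A.ς a) · ⟦ h ⟧ a
    ⟦a⟧≤⟦ςa⟧·⟦a⟧ = ≤-trans (mono (SA.≤ςa·a a)) (≤-reflexive (pres-· (A.ς a) a))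

    ⟦ςa⟧≤ς⟦a⟧ : ⟦ h ⟧ (A.ς a) ≤ ς (⟦ h ⟧ a)
    ⟦ςa⟧≤ς⟦a⟧ = begin
      ⟦ h ⟧ (A.ς a)                    ≈⟨ x≤e⇒ςx≈x ⟦ςa⟧≤e ⟨
      ς (⟦ h ⟧ (A.ς a))                ≤⟨ ς-mono (mono (SA.ς-≤aa* a)) ⟩
      ς (⟦ h ⟧ (a A.· a A.*))          ≈⟨ ς-cong (≈-trans (pres-· a (a A.*)) (·-cong ≈-refl (pres-* a))) ⟩
      ς (⟦ h ⟧ a · ⟦ h ⟧ a *)          ≤⟨ ς[a·a*]≤ςa (⟦ h ⟧ a) ⟩
      ς (⟦ h ⟧ a)                      ∎

module KripkeModelProperties {c ℓ ι} {P : Set} {Q : SSQ c ℓ ι} {α : SSQ.Carrier Q}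
  {v : Fm P → SSQ.Carrier Q} (M : IsKripkeModel Q α v) where
  open SSQ Q
  open IsStableSupport isStableSupport using (ς-cong; ς-⋁)
  open JoinLattice quantale
  open QuantaleProperties quantale
  open SupportProperties Q
  open IsKripkeModel M
  open ≤-Reasoning

  private
    module Dia = JoinPreserving quantale quantale (λ x → ς (α · x))
      (λ x≈y → ς-cong (·-cong ≈-refl x≈y))
      (λ f → ≈-trans (ς-cong (·-distribˡ-⋁ α f)) (ς-⋁ _))

  ◇-mono : ∀ {φ ψ} → v φ ≤ v ψ → v (◇ φ) ≤ v (◇ ψ)
  ◇-mono {φ} {ψ} vφ≤vψ = begin
    v (◇ φ)       ≈⟨ v-◇ φ ⟩
    ς (α · v φ)   ≤⟨ Dia.mono vφ≤vψ ⟩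
    ς (α · v ψ)   ≈⟨ v-◇ ψ ⟨
    v (◇ ψ)       ∎

  ◇-subadditive : ∀ {θ φ ψ} → v θ ≤ v φ ∨ v ψ → v (◇ θ) ≤ v (◇ φ) ∨ v (◇ ψ)
  ◇-subadditive {θ} {φ} {ψ} vθ≤vφ∨vψ = begin
    v (◇ θ)                         ≈⟨ v-◇ θ ⟩
    ς (α · v θ)                     ≤⟨ Dia.mono vθ≤vφ∨vψ ⟩
    ς (α · (v φ ∨ v ψ))             ≈⟨ Dia.pres-∨ (v φ) (v ψ) ⟩
    ς (α · v φ) ∨ ς (α · v ψ)       ≤⟨ ∨-mono (≤-reflexive (≈-sym (v-◇ φ))) (≤-reflexive (≈-sym (v-◇ ψ))) ⟩
    v (◇ φ) ∨ v (◇ ψ)               ∎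

  ◇-strict : ∀ {φ} → v φ ≤ 𝟘 → v (◇ φ) ≤ 𝟘
  ◇-strict {φ} vφ≤𝟘 = begin
    v (◇ φ)       ≈⟨ v-◇ φ ⟩
    ς (α · v φ)   ≤⟨ Dia.mono vφ≤𝟘 ⟩
    ς (α · 𝟘)     ≈⟨ Dia.pres-𝟘 ⟩
    𝟘             ∎

  v¬φ·vφ≈𝟘 : ∀ φ → v (¬ φ) · v φ ≈ 𝟘
  v¬φ·vφ≈𝟘 φ = ≈-trans (x,y≤e⇒x·y≈y·x (v-ςQ (¬ φ)) (v-ςQ φ)) (v-¬· φ)

  split : ∀ x φ → x ≈ x · v φ ∨ x · v (¬ φ)
  split x φ = begin-equality
    x                       ≈⟨ e-identityʳ x ⟨
    x · e                   ≈⟨ ·-cong ≈-refl (v-¬∨ φ) ⟨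
    x · (v φ ∨ v (¬ φ))     ≈⟨ ·-distribˡ-∨ x (v φ) (v (¬ φ)) ⟩
    x · v φ ∨ x · v (¬ φ)   ∎

  shunt : ∀ {x q} φ → x ≤ e → x · v φ ≤ q → x ≤ v (¬ φ) ∨ q
  shunt φ x≤e xvφ≤q = ≤-trans (≤-reflexive (split _ φ))
    (∨-least (≤-trans xvφ≤q (∨-upperʳ _ _)) (≤-trans (x≤e⇒x·y≤y x≤e) (∨-upperˡ _ _)))

  unshunt : ∀ {x q} φ → x ≤ v (¬ φ) ∨ q → x · v φ ≤ q
  unshunt {x} {q} φ x≤v¬φ∨q = begin
    x · v φ                       ≤⟨ ·-monoˡ (v φ) x≤v¬φ∨q ⟩
    (v (¬ φ) ∨ q) · v φ           ≈⟨ ·-distribʳ-∨ (v φ) (v (¬ φ)) q ⟩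
    v (¬ φ) · v φ ∨ q · v φ       ≤⟨ ∨-least (≤-trans (≤-reflexive (v¬φ·vφ≈𝟘 φ)) (𝟘-least q))
                                             (y≤e⇒x·y≤x (v-ςQ φ)) ⟩
    q                             ∎

  ¬-intro : ∀ {x} φ → x ≤ e → x · v φ ≤ 𝟘 → x ≤ v (¬ φ)
  ¬-intro φ x≤e xvφ≤𝟘 = ≤-trans (shunt φ x≤e xvφ≤𝟘) (∨-least ≤-refl (𝟘-least _))

  reductio : ∀ {x} φ → x ≤ e → x · v (¬ φ) ≤ 𝟘 → x ≤ v φ
  reductio φ x≤e xv¬φ≤𝟘 = ≤-trans (≤-reflexive (split _ φ))
    (∨-least (x≤e⇒x·y≤y x≤e) (≤-trans xv¬φ≤𝟘 (𝟘-least _)))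

  ¬¬-intro : ∀ φ → v φ ≤ v (¬ ¬ φ)
  ¬¬-intro φ = ¬-intro (¬ φ) (v-ςQ φ) (≤-reflexive (v-¬· φ))

  ¬¬-elim : ∀ φ → v (¬ ¬ φ) ≤ v φ
  ¬¬-elim φ = reductio φ (v-ςQ (¬ ¬ φ)) (≤-reflexive (v¬φ·vφ≈𝟘 (¬ φ)))

  ∨ᶠ-least : ∀ {φ ψ x} → v φ ≤ x → v ψ ≤ x → v (φ ∨ᶠ ψ) ≤ x
  ∨ᶠ-least {φ} {ψ} vφ≤x vψ≤x = ≤-trans (≤-reflexive (v-∨ φ ψ)) (∨-least vφ≤x vψ≤x)

  ∨ᶠ-upperˡ : ∀ φ ψ → v φ ≤ v (φ ∨ᶠ ψ)
  ∨ᶠ-upperˡ φ ψ = ≤-trans (∨-upperˡ _ _) (≤-reflexive (≈-sym (v-∨ φ ψ)))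

  ∨ᶠ-upperʳ : ∀ φ ψ → v ψ ≤ v (φ ∨ᶠ ψ)
  ∨ᶠ-upperʳ φ ψ = ≤-trans (∨-upperʳ _ _) (≤-reflexive (≈-sym (v-∨ φ ψ)))

  ⇒-intro : ∀ {x} φ ψ → x ≤ e → x · v φ ≤ v ψ → x ≤ v (φ ⇒ ψ)
  ⇒-intro φ ψ x≤e xvφ≤vψ = ≤-trans (shunt φ x≤e xvφ≤vψ) (≤-reflexive (≈-sym (v-∨ (¬ φ) ψ)))

  ⇒-elim : ∀ {x} φ ψ → x ≤ v (φ ⇒ ψ) → x · v φ ≤ v ψ
  ⇒-elim φ ψ x≤vφ⇒ψ = unshunt φ (≤-trans x≤vφ⇒ψ (≤-reflexive (v-∨ (¬ φ) ψ)))

  valid-⇒-intro : ∀ {φ ψ} → v φ ≤ v ψ → e ≤ v (φ ⇒ ψ)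
  valid-⇒-intro {φ} {ψ} vφ≤vψ =
    ⇒-intro φ ψ ≤-refl (≤-trans (≤-reflexive (e-identityˡ (v φ))) vφ≤vψ)

  valid-⇒-elim : ∀ {φ ψ} → e ≤ v (φ ⇒ ψ) → v φ ≤ v ψ
  valid-⇒-elim {φ} {ψ} e≤vφ⇒ψ = ≤-trans (≤-reflexive (≈-sym (e-identityˡ (v φ)))) (⇒-elim φ ψ e≤vφ⇒ψ)

  sum-sound : ∀ φ ψ χ → v (ψ ⇒ χ) ≤ v ((φ ∨ᶠ ψ) ⇒ (φ ∨ᶠ χ))
  sum-sound φ ψ χ = ⇒-intro (φ ∨ᶠ ψ) (φ ∨ᶠ χ) x≤e (begin
    x · v (φ ∨ᶠ ψ)          ≈⟨ ·-cong ≈-refl (v-∨ φ ψ) ⟩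
    x · (v φ ∨ v ψ)         ≈⟨ ·-distribˡ-∨ x (v φ) (v ψ) ⟩
    x · v φ ∨ x · v ψ       ≤⟨ ∨-least (≤-trans (x≤e⇒x·y≤y x≤e) (∨ᶠ-upperˡ φ χ))
                                       (≤-trans (⇒-elim ψ χ ≤-refl) (∨ᶠ-upperʳ φ χ)) ⟩
    v (φ ∨ᶠ χ)              ∎)
    where
    x = v (ψ ⇒ χ)
    x≤e = v-ςQ (ψ ⇒ χ)

  -- Since ◇ preserves joins, ◇¬ψ ≤ ◇¬(φ ⇒ ψ) ∨ ◇¬φ, and the two hypotheses exclude both disjuncts.
  K-sound : ∀ φ ψ → v (□ (φ ⇒ ψ)) ≤ v (□ φ ⇒ □ ψ)
  K-sound φ ψ = ⇒-intro (□ φ) (□ ψ) x≤e (¬-intro (◇ ¬ ψ) (x,y≤e⇒x·y≤e x≤e y≤e) (begin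
    (x · y) · v (◇ ¬ ψ)             ≤⟨ ·-monoʳ (x · y) (◇-subadditive ¬ψ≤¬[φ⇒ψ]∨¬φ) ⟩
    (x · y) · (u ∨ w)               ≈⟨ ·-distribˡ-∨ (x · y) u w ⟩
    (x · y) · u ∨ (x · y) · w       ≤⟨ ∨-least
      (≤-trans (·-monoˡ u (y≤e⇒x·y≤x y≤e)) (≤-reflexive (v¬φ·vφ≈𝟘 (◇ ¬ (φ ⇒ ψ)))))
      (≤-trans (·-monoˡ w (x≤e⇒x·y≤y x≤e)) (≤-reflexive (v¬φ·vφ≈𝟘 (◇ ¬ φ)))) ⟩
    𝟘                               ∎))
    where
    x = v (□ (φ ⇒ ψ))
    y = v (□ φ)
    u = v (◇ ¬ (φ ⇒ ψ))
    w = v (◇ ¬ φ)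
    x≤e = v-ςQ (□ (φ ⇒ ψ))
    y≤e = v-ςQ (□ φ)

    ¬ψ≤¬[φ⇒ψ]∨¬φ : v (¬ ψ) ≤ v (¬ (φ ⇒ ψ)) ∨ v (¬ φ)
    ¬ψ≤¬[φ⇒ψ]∨¬φ = shunt (φ ⇒ ψ) (v-ςQ (¬ ψ)) (begin
      v (¬ ψ) · v (φ ⇒ ψ)                     ≈⟨ ·-cong ≈-refl (v-∨ (¬ φ) ψ) ⟩
      v (¬ ψ) · (v (¬ φ) ∨ v ψ)               ≈⟨ ·-distribˡ-∨ (v (¬ ψ)) (v (¬ φ)) (v ψ) ⟩
      v (¬ ψ) · v (¬ φ) ∨ v (¬ ψ) · v ψ       ≤⟨ ∨-least (x≤e⇒x·y≤y (v-ςQ (¬ ψ)))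
                                                   (≤-trans (≤-reflexive (v¬φ·vφ≈𝟘 ψ)) (𝟘-least _)) ⟩
      v (¬ φ)                                 ∎)

  nec-sound : ∀ {φ} → e ≤ v φ → e ≤ v (□ φ)
  nec-sound {φ} e≤vφ = ¬-intro (◇ ¬ φ) ≤-refl (begin
    e · v (◇ ¬ φ)   ≈⟨ e-identityˡ _ ⟩
    v (◇ ¬ φ)       ≤⟨ ◇-strict v¬φ≤𝟘 ⟩
    𝟘               ∎)
    where
    v¬φ≤𝟘 : v (¬ φ) ≤ 𝟘
    v¬φ≤𝟘 = begin
      v (¬ φ)             ≈⟨ e-identityˡ _ ⟨
      e · v (¬ φ)         ≤⟨ ·-monoˡ (v (¬ φ)) e≤vφ ⟩
      v φ · v (¬ φ)       ≈⟨ v-¬· φ ⟩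
      𝟘                   ∎

  sound : ∀ {φ} → ⊢K φ → e ≤ v φ
  sound (taut φ)      = valid-⇒-intro (∨ᶠ-least ≤-refl ≤-refl)
  sound (add φ ψ)     = valid-⇒-intro (∨ᶠ-upperʳ φ ψ)
  sound (perm φ ψ)    = valid-⇒-intro (∨ᶠ-least (∨ᶠ-upperʳ ψ φ) (∨ᶠ-upperˡ ψ φ))
  sound (assoc φ ψ χ) = valid-⇒-intro
    (∨ᶠ-least (≤-trans (∨ᶠ-upperˡ φ χ) (∨ᶠ-upperʳ ψ (φ ∨ᶠ χ)))
              (∨ᶠ-least (∨ᶠ-upperˡ ψ (φ ∨ᶠ χ))
                        (≤-trans (∨ᶠ-upperʳ φ χ) (∨ᶠ-upperʳ ψ (φ ∨ᶠ χ)))))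
  sound (sum φ ψ χ)   = valid-⇒-intro (sum-sound φ ψ χ)
  sound (axK φ ψ)     = valid-⇒-intro (K-sound φ ψ)
  sound (dual₁ φ)     = valid-⇒-intro (≤-trans (◇-mono (¬¬-intro φ)) (¬¬-intro (◇ ¬ ¬ φ)))
  sound (dual₂ φ)     = valid-⇒-intro (≤-trans (¬¬-elim (◇ ¬ ¬ φ)) (◇-mono (¬¬-elim φ)))
  sound (mp ⊢φ ⊢φ⇒ψ)  = ≤-trans (sound ⊢φ) (valid-⇒-elim (sound ⊢φ⇒ψ))
  sound (nec ⊢φ)      = nec-sound (sound ⊢φ)

  satisfiesLindRelations : SatisfiesLindRelations Q α v
  satisfiesLindRelations = record
    { f-resp = λ { (⊢φ⇒ψ , ⊢ψ⇒φ) → ≤-antisym (valid-⇒-elim (sound ⊢φ⇒ψ)) (valid-⇒-elim (sound ⊢ψ⇒φ)) }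
    ; r-∨    = v-∨
    ; r-¬·   = v¬φ·vφ≈𝟘
    ; r-¬∨   = λ φ → ≈-trans (∨-comm _ _) (v-¬∨ φ)
    ; r-◇    = v-◇
    }

module _ {c ℓ ι c₁ ℓ₁} {P : Set} {L : SSQ c₁ ℓ₁ ι} {𝛂 : SSQ.Carrier L} {gen : Fm P → SSQ.Carrier L}
  (R : SatisfiesLindRelations L 𝛂 gen) {Q : SSQ c ℓ ι} (h : Hom L Q) where
  private
    module L = SSQ L
    module LL = JoinLattice L.quantale
  open SSQ Q
  open IsStableSupport isStableSupport using (ς-cong)
  open JoinLattice quantale
  open SatisfiesLindRelations R
  open SupportProperties L using (x,y≤e⇒x·y≈y·x)
  open HomProperties h
  open Hom h using (cong; pres-·; pres-e)

  gen≤e : ∀ φ → gen φ L.≤ L.e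
  gen≤e φ = LL.≤-trans (LL.∨-upperʳ _ _) (LL.≤-reflexive (r-¬∨ φ))

  hom⇒isKripkeModel : IsKripkeModel Q (⟦ h ⟧ 𝛂) (λ φ → ⟦ h ⟧ (gen φ))
  hom⇒isKripkeModel = record
    { v-ςQ = λ φ → pres-≤e (gen≤e φ)
    ; v-∨  = λ φ ψ → ≈-trans (cong (r-∨ φ ψ)) (pres-∨ _ _)
    ; v-¬· = λ φ → ≈-trans (≈-sym (pres-· _ _))
        (≈-trans (cong (LL.≈-trans (x,y≤e⇒x·y≈y·x (gen≤e φ) (gen≤e (¬ φ))) (r-¬· φ))) pres-𝟘)
    ; v-¬∨ = λ φ → ≈-trans (≈-sym (pres-∨ _ _))
        (≈-trans (cong (LL.≈-trans (LL.∨-comm _ _) (r-¬∨ φ))) pres-e)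
    ; v-◇  = λ φ → ≈-trans (cong (r-◇ φ)) (≈-trans (pres-ς _) (ς-cong (pres-· 𝛂 (gen φ))))
    }

mainTheorem18 : ∀ {c ℓ ι c₁ ℓ₁ : Level} {P : Set}
    (L : SSQ c₁ ℓ₁ ι) (𝛂 : SSQ.Carrier L) (gen : Fm P → SSQ.Carrier L) →
    IsLindK c ℓ ι L 𝛂 gen →
    (Q : SSQ c ℓ ι) →
    ((h : Hom L Q) → IsKripkeModel Q (⟦ h ⟧ 𝛂) (λ φ → ⟦ h ⟧ (gen φ)))
    × ((α : SSQ.Carrier Q) (v : Fm P → SSQ.Carrier Q) → IsKripkeModel Q α v →
       Σ[ h ∈ Hom L Q ] ((SSQ._≈_ Q (⟦ h ⟧ 𝛂) α) × (∀ φ → SSQ._≈_ Q (⟦ h ⟧ (gen φ)) (v φ))))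
    × ((h h′ : Hom L Q) → SSQ._≈_ Q (⟦ h ⟧ 𝛂) (⟦ h′ ⟧ 𝛂) →
       (∀ φ → SSQ._≈_ Q (⟦ h ⟧ (gen φ)) (⟦ h′ ⟧ (gen φ))) →
       ∀ x → SSQ._≈_ Q (⟦ h ⟧ x) (⟦ h′ ⟧ x))
mainTheorem18 L 𝛂 gen isLindK Q =
    hom⇒isKripkeModel gen-rel
  , (λ α v M → universal Q α v (KripkeModelProperties.satisfiesLindRelations M))
  , unique Q
  where open IsLindK isLindK
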